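{- Let $\mathbf{L}\in\{\mathbf{K},\mathbf{T},\mathbf{K4},\mathbf{S4}\}$. Then $\mathbf{L}^{Horn,\Diamond}$ is closed under product of models: for every $\mathbf{L}^{Horn,\Diamond}$-formula $\varphi$ and all models $M_1=((W_1,R_1),V_1)$, $M_2=((W_2,R_2),V_2)$ over frames in the frame class of $\mathbf{L}$ and worlds $w_1\in W_1$, $w_2\in W_2$, if $M_1,w_1\models\varphi$ and $M_2,w_2\models\varphi$ then $M_{M_1\times M_2},(w_1,w_2)\models\varphi$.
   Context: Fix a countable set $\mathcal P$ of propositional letters; Kripke models $((W,R),V)$ with $V:W\to2^{\mathcal P}$ and standard modal satisfaction. $\mathbf{K},\mathbf{T},\mathbf{K4},\mathbf{S4}$ are interpreted over all, reflexive, transitive, and reflexive-transitive frames respectively. Diamond positive literals: $\lambda ::= \top\mid p\mid \Diamond\lambda$. An $\mathbf{L}^{Horn,\Diamond}$-formula is a finite conjunction of clauses $\Box^s(\neg\lambda_1\vee\dots\vee\neg\lambda_n\vee\lambda_{n+1}\vee\dots\vee\lambda_{n+m})$ with $s,n\ge0$, $m\le1$, each $\lambda_i$ a diamond positive literal ($\Box^s$ = $s$ nested boxes). The product model $M_{M_1\times M_2}$ has worlds $W_1\times W_2$, relation $(u_1,u_2)R(v_1,v_2)$ iff $u_1R_1v_1$ and $u_2R_2v_2$, and valuation $V((u_1,u_2))=V_1(u_1)\cap V_2(u_2)$. -}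

module Defs where

open import Level using (Level; _⊔_) renaming (suc to lsuc; zero to lzero)
open import Data.Nat using (ℕ; zero; suc)
open import Data.List using (List; []; _∷_)
open import Data.Maybe using (Maybe; just; nothing)
open import Data.Product using (Σ; _×_; _,_)
open import Data.Unit.Polymorphic using (⊤)
open import Data.Empty.Polymorphic using (⊥)
open import Relation.Unary using (Pred; _∈_; _∩_)
open import Relation.Binary.Definitions using (Reflexive; Transitive)

Letter : Set
Letter = ℕ

record Frame : Set₁ where
  field
    W : Set
    R : W → W → Set

record Model : Set₁ where
  field
    frame : Frame
  open Frame frame public
  field
    V : W → Pred Letter lzero

data Logic : Set where
  K T K4 S4 : Logic

InClass : Logic → Frame → Set
InClass K  F = ⊤
InClass T  F = Reflexive (Frame.R F)
InClass K4 F = Transitive (Frame.R F)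
InClass S4 F = Reflexive (Frame.R F) × Transitive (Frame.R F)

data Form : Set where
  ⊤ᶠ ⊥ᶠ  : Form
  var    : Letter → Form
  ¬ᶠ_    : Form → Form
  _∧ᶠ_ _∨ᶠ_ : Form → Form → Form
  □_ ◇_  : Form → Form

-- Negation is →⊥; disjunction is read classically as ¬(¬A × ¬B),
-- since the metatheory of Kripke semantics is classical.
_⊨_at_ : (M : Model) → Form → Model.W M → Set
M ⊨ ⊤ᶠ at w = ⊤
M ⊨ ⊥ᶠ at w = ⊥
M ⊨ var p at w = p ∈ Model.V M w
M ⊨ ¬ᶠ φ at w = M ⊨ φ at w → ⊥
M ⊨ φ ∧ᶠ ψ at w = (M ⊨ φ at w) × (M ⊨ ψ at w)
M ⊨ φ ∨ᶠ ψ at w = ((M ⊨ φ at w → ⊥) × (M ⊨ ψ at w → ⊥)) → ⊥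
M ⊨ □ φ at w = ∀ v → Model.R M w v → M ⊨ φ at v
M ⊨ ◇ φ at w = Σ (Model.W M) λ v → Model.R M w v × M ⊨ φ at v

data DLit : Set where
  top : DLit
  lit : Letter → DLit
  dia : DLit → DLit

DLit→Form : DLit → Form
DLit→Form top     = ⊤ᶠ
DLit→Form (lit p) = var p
DLit→Form (dia l) = ◇ (DLit→Form l)

-- A clause □^s(¬λ₁ ∨ … ∨ ¬λₙ ∨ λ_{n+1} ∨ … ∨ λ_{n+m}), m ≤ 1
record Clause : Set where
  constructor clause
  field
    boxes : ℕ
    negs  : List DLit
    pos   : Maybe DLit

boxN : ℕ → Form → Form
boxN zero    φ = φ
boxN (suc s) φ = □ (boxN s φ)

disj : List DLit → Maybe DLit → Form
disj []       nothing  = ⊥ᶠ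
disj []       (just l) = DLit→Form l
disj (l ∷ ls) m        = (¬ᶠ DLit→Form l) ∨ᶠ disj ls m

Clause→Form : Clause → Form
Clause→Form (clause s ns p) = boxN s (disj ns p)

HornDia : Set
HornDia = List Clause

HornDia→Form : HornDia → Form
HornDia→Form []       = ⊤ᶠ
HornDia→Form (c ∷ cs) = Clause→Form c ∧ᶠ HornDia→Form cs

productFrame : Frame → Frame → Frame
productFrame F₁ F₂ = record
  { W = Frame.W F₁ × Frame.W F₂
  ; R = λ { (u₁ , u₂) (v₁ , v₂) → Frame.R F₁ u₁ v₁ × Frame.R F₂ u₂ v₂ }
  }

productModel : Model → Model → Model
productModel M₁ M₂ = record
  { frame = productFrame (Model.frame M₁) (Model.frame M₂)
  ; V = λ { (u₁ , u₂) → Model.V M₁ u₁ ∩ Model.V M₂ u₂ }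
  }

-- A diamond positive literal holds at a pair of worlds iff it holds at both
-- components: ◇-witnesses in the factors pair up to a witness in the product,
-- and a witness in the product projects to witnesses in the factors.  So if a
-- Horn clause body ¬λ₁ ∨ … ∨ ¬λₙ ∨ λ fails at a pair, every λᵢ holds at the
-- pair, hence in both factors, hence λ holds in both factors and so at the
-- pair.  Boxes and conjunctions are preserved because the product relation is
-- componentwise.  No frame condition is used, so the result holds for every L.
module Submission where

open import Defs
open import Data.Product using (_×_; _,_; proj₁; proj₂)
open import Data.Nat using (zero; suc)
open import Data.List using ([]; _∷_)
open import Data.Maybe using (just; nothing)

-- Records rather than synonyms: _⊨_at_ computes, so φ could not be recovered
-- by unification from the unfolded Π-type.
record ProductClosed (φ : Form) : Set₁ where
  constructor closedBy
  field
    pair : ∀ {M₁ M₂ u₁ u₂}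
      → M₁ ⊨ φ at u₁ → M₂ ⊨ φ at u₂ → productModel M₁ M₂ ⊨ φ at (u₁ , u₂)

record ProductProjected (φ : Form) : Set₁ where
  constructor projectedBy
  field
    unpair : ∀ {M₁ M₂ u₁ u₂}
      → productModel M₁ M₂ ⊨ φ at (u₁ , u₂) → M₁ ⊨ φ at u₁ × M₂ ⊨ φ at u₂

open ProductClosed
open ProductProjected

⊤-closed : ProductClosed ⊤ᶠ
⊤-closed = closedBy λ a _ → a

⊥-closed : ProductClosed ⊥ᶠ
⊥-closed = closedBy λ a _ → a

var-closed : ∀ p → ProductClosed (var p)
var-closed p = closedBy _,_

◇-closed : ∀ {φ} → ProductClosed φ → ProductClosed (◇ φ)
◇-closed φ-closed = closedBy λ where
  (v₁ , r₁ , a) (v₂ , r₂ , b) → (v₁ , v₂) , (r₁ , r₂) , pair φ-closed a b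

□-closed : ∀ {φ} → ProductClosed φ → ProductClosed (□ φ)
□-closed φ-closed = closedBy λ a b (v₁ , v₂) (r₁ , r₂) →
  pair φ-closed (a v₁ r₁) (b v₂ r₂)

∧-closed : ∀ {φ ψ} → ProductClosed φ → ProductClosed ψ → ProductClosed (φ ∧ᶠ ψ)
∧-closed φ-closed ψ-closed = closedBy λ (a , a′) (b , b′) →
  pair φ-closed a b , pair ψ-closed a′ b′

-- The classical disjunction is refuted at the pair by refuting it in the first
-- factor, whose ψ-disjunct is refuted in turn by refuting it in the second.
¬∨-closed : ∀ {χ ψ} → ProductProjected χ → ProductClosed ψ
  → ProductClosed ((¬ᶠ χ) ∨ᶠ ψ)
¬∨-closed χ-projected ψ-closed = closedBy λ a b (¬¬χ , ¬ψ) →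
  a ( (λ ¬χ₁ → ¬¬χ (λ χ → ¬χ₁ (proj₁ (unpair χ-projected χ))))
    , λ ψ₁ → b ( (λ ¬χ₂ → ¬¬χ (λ χ → ¬χ₂ (proj₂ (unpair χ-projected χ))))
               , λ ψ₂ → ¬ψ (pair ψ-closed ψ₁ ψ₂)))

boxN-closed : ∀ s {φ} → ProductClosed φ → ProductClosed (boxN s φ)
boxN-closed zero    φ-closed = φ-closed
boxN-closed (suc s) φ-closed = □-closed (boxN-closed s φ-closed)

⊤-projected : ProductProjected ⊤ᶠ
⊤-projected = projectedBy λ a → a , a

var-projected : ∀ p → ProductProjected (var p)
var-projected p = projectedBy λ a → a

◇-projected : ∀ {φ} → ProductProjected φ → ProductProjected (◇ φ)
◇-projected φ-projected = projectedBy λ ((v₁ , v₂) , (r₁ , r₂) , a) →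
  let (a₁ , a₂) = unpair φ-projected a in (v₁ , r₁ , a₁) , (v₂ , r₂ , a₂)

DLit-closed : ∀ l → ProductClosed (DLit→Form l)
DLit-closed top     = ⊤-closed
DLit-closed (lit p) = var-closed p
DLit-closed (dia l) = ◇-closed (DLit-closed l)

DLit-projected : ∀ l → ProductProjected (DLit→Form l)
DLit-projected top     = ⊤-projected
DLit-projected (lit p) = var-projected p
DLit-projected (dia l) = ◇-projected (DLit-projected l)

disj-closed : ∀ ls m → ProductClosed (disj ls m)
disj-closed []       nothing  = ⊥-closed
disj-closed []       (just l) = DLit-closed l
disj-closed (l ∷ ls) m        = ¬∨-closed (DLit-projected l) (disj-closed ls m)

Clause-closed : ∀ c → ProductClosed (Clause→Form c)
Clause-closed (clause s ls m) = boxN-closed s (disj-closed ls m)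

HornDia-closed : ∀ φ → ProductClosed (HornDia→Form φ)
HornDia-closed []       = ⊤-closed
HornDia-closed (c ∷ cs) = ∧-closed (Clause-closed c) (HornDia-closed cs)

lemma3p7 : (L : Logic) (φ : HornDia) (M₁ M₂ : Model)
    → InClass L (Model.frame M₁) → InClass L (Model.frame M₂)
    → (w₁ : Model.W M₁) (w₂ : Model.W M₂)
    → M₁ ⊨ HornDia→Form φ at w₁
    → M₂ ⊨ HornDia→Form φ at w₂
    → productModel M₁ M₂ ⊨ HornDia→Form φ at (w₁ , w₂)
lemma3p7 _ φ _ _ _ _ _ _ = pair (HornDia-closed φ)
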